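{- Let $q$ be a power of an odd prime. Then all Golomb-Costas arrays of order $q-2$ have the same number of even/even dots, the same number of odd/odd dots, the same number of even/odd dots, and the same number of odd/even dots.
   Context: $\mathbb{F}_q$ is the finite field with $q$ elements and $\mathbb{F}_q^*$ its cyclic multiplicative group. Given generators $\alpha,\beta$ of $\mathbb{F}_q^*$ (possibly $\alpha=\beta$), the Golomb-Costas array of order $q-2$ is the $(q-2)\times(q-2)$ array with a dot in position $(i,j)$ (row $i$, column $j$, $1\le i,j\le q-2$) exactly when $\alpha^i+\beta^j=1$; the Golomb-Costas arrays of order $q-2$ are all arrays arising this way from some pair of generators. A dot in row $i$, column $j$ is even/even if $i,j$ are both even, odd/odd if both are odd, even/odd if $i$ is even and $j$ odd, odd/even if $i$ is odd and $j$ even. -}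

module Defs where

open import Level using (0ℓ)
open import Data.Nat using (ℕ; zero; suc; _∸_; _%_)
open import Data.Fin as Fin using (Fin)
open import Data.Fin.Properties using () renaming (_≟_ to _≟ᶠ_)
open import Data.List using (List; length; filter; cartesianProduct; upTo; map)
open import Data.Product using (Σ; ∃; _×_; _,_; proj₁; proj₂)
open import Relation.Nullary using (¬_; Dec; yes; no)
open import Relation.Nullary.Decidable using (_×-dec_)
open import Relation.Binary.PropositionalEquality using (_≡_; _≢_; refl; cong; sym; trans)
open import Algebra.Structures using (IsCommutativeRing)
open import Function.Bundles using (_↔_; Inverse)
open import Data.Nat.Properties using () renaming (_≟_ to _≟ℕ_)

record FiniteField (q : ℕ) : Set₁ where
  field
    Carrier : Set
    _+_ _*_ : Carrier → Carrier → Carrier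
    -_ : Carrier → Carrier
    0# 1# : Carrier
    isCommutativeRing : IsCommutativeRing _≡_ _+_ _*_ -_ 0# 1#
    1≢0 : 1# ≢ 0#
    inverse : ∀ x → x ≢ 0# → ∃ λ y → x * y ≡ 1#
    enumeration : Carrier ↔ Fin q

  _≟_ : (x y : Carrier) → Dec (x ≡ y)
  x ≟ y with Inverse.to enumeration x ≟ᶠ Inverse.to enumeration y
  ... | yes p = yes (trans (sym (Inverse.strictlyInverseʳ enumeration x))
                     (trans (cong (Inverse.from enumeration) p)
                            (Inverse.strictlyInverseʳ enumeration y)))
  ... | no ¬p = no (λ e → ¬p (cong (Inverse.to enumeration) e))

  _^_ : Carrier → ℕ → Carrier
  x ^ zero = 1#
  x ^ suc n = x * (x ^ n)

  IsGenerator : Carrier → Set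
  IsGenerator α = α ≢ 0# × (∀ x → x ≢ 0# → ∃ λ k → α ^ k ≡ x)

indices : ℕ → List ℕ
indices q = map suc (upTo (q ∸ 2))

dotCount : ∀ {q} (F : FiniteField q) → FiniteField.Carrier F → FiniteField.Carrier F
         → ℕ → ℕ → ℕ
dotCount {q} F α β a b =
  length (filter (λ ij → ((proj₁ ij % 2) ≟ℕ a ×-dec (proj₂ ij % 2) ≟ℕ b)
                          ×-dec ((α ^ proj₁ ij) + (β ^ proj₂ ij)) ≟ 1#)
                 (cartesianProduct (indices q) (indices q)))
  where open FiniteField F

-- dot counts of the Golomb-Costas array given by generators α β (row i, column j)
evenEven oddOdd evenOdd oddEven : ∀ {q} (F : FiniteField q) → FiniteField.Carrier F → FiniteField.Carrier F → ℕ
evenEven F α β = dotCount F α β 0 0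
oddOdd   F α β = dotCount F α β 1 1
evenOdd  F α β = dotCount F α β 0 1
oddEven  F α β = dotCount F α β 1 0

module Submission where

-- For generators α, α′ and i ∈ I let i′ ∈ I be the exponent with α′^i′ = α^i.
-- Writing α = α′^c we get i′ ≡ i·c (mod n); as n is even, i even forces i′ even, and
-- by symmetry i and i′ have the same parity.  So replacing α by α′ moves the dots
-- of row i to row i′ without changing the parity class of any dot.
--
-- Counting the dots row by
-- row changes β, column by column changes α, giving Corollary 7.

open import Defs
open import Data.Nat.Primality using (Prime)
open import Data.Product using (_×_)
open import Relation.Binary.PropositionalEquality using (_≡_)

open import Level using (Level; 0ℓ)
open import Data.Nat using (ℕ; zero; suc; _%_; _∸_; _<_; _≤_; _/_; z≤n; s≤s; NonZero)
import Data.Nat as ℕ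
import Data.Nat.Properties as ℕ
open import Data.Nat.Properties using () renaming (_≟_ to _≟ℕ_)
open import Data.Nat.DivMod using (m≡m%n+[m/n]*n; m%n<n; %-distribˡ-+; %-distribˡ-*)
open import Data.Nat.Divisibility using (_∣_; m%n≡0⇒n∣m; n∣m⇒m%n≡0; ∣m⇒∣m*n; %-presˡ-∣)
open import Data.Fin using (Fin; toℕ; fromℕ<; punchIn; punchOut) renaming (_<_ to _<ᶠ_)
import Data.Fin.Properties as Fin
open import Data.List using (List; []; _∷_; _++_; map; length; filter; cartesianProduct)
import Data.List.Properties as List
open import Data.List.Membership.Propositional using (_∈_; find; lose)
open import Data.List.Membership.Propositional.Properties using (∈-map⁺; ∈-map⁻; ∈-upTo⁺; ∈-upTo⁻)
open import Data.List.Relation.Unary.Any using (Any; here; there; any?)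
open import Data.List.Relation.Unary.All using () renaming (lookup to All-lookup)
open import Data.List.Relation.Unary.All.Properties using (¬Any⇒All¬)
open import Data.List.Relation.Unary.Unique.Propositional using (Unique; []; _∷_)
import Data.List.Relation.Unary.Unique.Propositional.Properties as Unique
open import Data.Product using (∃; ∃₂; _,_; proj₁; proj₂)
open import Data.Sum using (_⊎_; inj₁; inj₂)
open import Relation.Nullary using (¬_; Dec; yes; no; contradiction)
open import Relation.Nullary.Decidable using (_×-dec_)
open import Relation.Unary using (Pred; Decidable)
open import Relation.Binary.Definitions using (tri<; tri≈; tri>)
open import Relation.Binary.PropositionalEquality using (_≢_; refl; sym; trans; cong; cong₂; subst; subst₂; module ≡-Reasoning)
open import Algebra.Bundles using (CommutativeRing)
open import Algebra.Properties.CommutativeSemigroup ℕ.+-commutativeSemigroup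
  using () renaming (interchange to +-interchange)
open import Function using (_∘_)
open import Function.Bundles using (Inverse)

module ListCounting where
  open import Data.Nat using (_+_)

  count : {A : Set} {ℓ : Level} {P : Pred A ℓ} → Decidable P → List A → ℕ
  count P? xs = length (filter P? xs)

  ∑ : {A : Set} → List A → (A → ℕ) → ℕ
  ∑ []       f = 0
  ∑ (x ∷ xs) f = f x + ∑ xs f

  𝟙 : {ℓ : Level} {P : Set ℓ} → Dec P → ℕ
  𝟙 (yes _) = 1
  𝟙 (no _)  = 0

  module _ {A : Set} where

    ∑-cong : (xs : List A) {f g : A → ℕ} → (∀ x → f x ≡ g x) → ∑ xs f ≡ ∑ xs g
    ∑-cong []       f≗g = refl
    ∑-cong (x ∷ xs) f≗g = cong₂ _+_ (f≗g x) (∑-cong xs f≗g)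

    ∑-+ : (xs : List A) (f g : A → ℕ) → ∑ xs (λ x → f x + g x) ≡ ∑ xs f + ∑ xs g
    ∑-+ []       f g = refl
    ∑-+ (x ∷ xs) f g = begin
      (f x + g x) + ∑ xs (λ x → f x + g x) ≡⟨ cong ((f x + g x) +_) (∑-+ xs f g) ⟩
      (f x + g x) + (∑ xs f + ∑ xs g)      ≡⟨ +-interchange (f x) (g x) (∑ xs f) (∑ xs g) ⟩
      (f x + ∑ xs f) + (g x + ∑ xs g)      ∎
      where open ≡-Reasoning

    ∑-zero : (xs : List A) → ∑ xs (λ _ → 0) ≡ 0
    ∑-zero []       = refl
    ∑-zero (x ∷ xs) = ∑-zero xs

  module _ {A : Set} {ℓ : Level} {P : Pred A ℓ} (P? : Decidable P) where

    count-∷ : ∀ x xs → count P? (x ∷ xs) ≡ 𝟙 (P? x) + count P? xs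
    count-∷ x xs with P? x
    ... | yes _ = refl
    ... | no  _ = refl

    count-++ : ∀ xs ys → count P? (xs ++ ys) ≡ count P? xs + count P? ys
    count-++ xs ys = trans (cong length (List.filter-++ P? xs ys)) (List.length-++ (filter P? xs))

    count-as-∑ : ∀ xs → count P? xs ≡ ∑ xs (𝟙 ∘ P?)
    count-as-∑ []       = refl
    count-as-∑ (x ∷ xs) = trans (count-∷ x xs) (cong (𝟙 (P? x) +_) (count-as-∑ xs))

  count-map : {A B : Set} {ℓ : Level} {P : Pred B ℓ} (P? : Decidable P) (f : A → B) (xs : List A) →
              count P? (map f xs) ≡ count (P? ∘ f) xs
  count-map P? f []       = refl
  count-map P? f (x ∷ xs) = begin
    count P? (f x ∷ map f xs)         ≡⟨ count-∷ P? (f x) (map f xs) ⟩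
    𝟙 (P? (f x)) + count P? (map f xs) ≡⟨ cong (𝟙 (P? (f x)) +_) (count-map P? f xs) ⟩
    𝟙 (P? (f x)) + count (P? ∘ f) xs   ≡⟨ count-∷ (P? ∘ f) x xs ⟨
    count (P? ∘ f) (x ∷ xs)           ∎
    where open ≡-Reasoning

  module _ {A B : Set} {ℓ : Level} {P : Pred (A × B) ℓ} (P? : Decidable P) where

    count-cartesianProduct : ∀ xs ys →
      count P? (cartesianProduct xs ys) ≡ ∑ xs (λ x → count (λ y → P? (x , y)) ys)
    count-cartesianProduct []       ys = refl
    count-cartesianProduct (x ∷ xs) ys = begin
      count P? (map (x ,_) ys ++ cartesianProduct xs ys)
        ≡⟨ count-++ P? (map (x ,_) ys) _ ⟩
      count P? (map (x ,_) ys) + count P? (cartesianProduct xs ys)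
        ≡⟨ cong₂ _+_ (count-map P? (x ,_) ys) (count-cartesianProduct xs ys) ⟩
      count (λ y → P? (x , y)) ys + ∑ xs (λ x → count (λ y → P? (x , y)) ys) ∎
      where open ≡-Reasoning

    count-cartesianProduct-columns : ∀ xs ys →
      count P? (cartesianProduct xs ys) ≡ ∑ ys (λ y → count (λ x → P? (x , y)) xs)
    count-cartesianProduct-columns []       ys = sym (∑-zero ys)
    count-cartesianProduct-columns (x ∷ xs) ys = begin
      count P? (map (x ,_) ys ++ cartesianProduct xs ys)
        ≡⟨ count-++ P? (map (x ,_) ys) _ ⟩
      count P? (map (x ,_) ys) + count P? (cartesianProduct xs ys)
        ≡⟨ cong₂ _+_ (count-map P? (x ,_) ys) (count-cartesianProduct-columns xs ys) ⟩
      count (λ y → P? (x , y)) ys + ∑ ys (λ y → count (λ x → P? (x , y)) xs)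
        ≡⟨ cong (_+ _) (count-as-∑ (λ y → P? (x , y)) ys) ⟩
      ∑ ys (λ y → 𝟙 (P? (x , y))) + ∑ ys (λ y → count (λ x → P? (x , y)) xs)
        ≡⟨ ∑-+ ys (λ y → 𝟙 (P? (x , y))) _ ⟨
      ∑ ys (λ y → 𝟙 (P? (x , y)) + count (λ x → P? (x , y)) xs)
        ≡⟨ ∑-cong ys (λ y → count-∷ (λ x → P? (x , y)) x xs) ⟨
      ∑ ys (λ y → count (λ x → P? (x , y)) (x ∷ xs)) ∎
      where open ≡-Reasoning

  AtMostOnce : {A : Set} {ℓ : Level} → Pred A ℓ → List A → Set _
  AtMostOnce P xs = ∀ {x y} → x ∈ xs → y ∈ xs → P x → P y → x ≡ y

  module _ {A : Set} {ℓ : Level} {P : Pred A ℓ} (P? : Decidable P) where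

    count-none : ∀ {xs} → ¬ Any P xs → count P? xs ≡ 0
    count-none {xs} ¬any = cong length (List.filter-none P? (¬Any⇒All¬ xs ¬any))

    count-once : ∀ {xs} → Unique xs → AtMostOnce P xs → Any P xs → count P? xs ≡ 1
    count-once {x ∷ xs} (x∉xs ∷ unique) once any with P? x
    ... | yes px = cong suc (count-none (λ any′ → let y , y∈xs , py = find any′ in
                     All-lookup x∉xs y∈xs (once (here refl) (there y∈xs) px py)))
    ... | no ¬px with any
    ...   | here px    = contradiction px ¬px
    ...   | there any′ = count-once unique (λ x∈ y∈ → once (there x∈) (there y∈)) any′

  count-once-cong : {A B : Set} {ℓ ℓ′ : Level} {P : Pred A ℓ} {Q : Pred B ℓ′}
    (P? : Decidable P) (Q? : Decidable Q) {xs : List A} {ys : List B} →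
    Unique xs → Unique ys → AtMostOnce P xs → AtMostOnce Q ys →
    (Any P xs → Any Q ys) → (Any Q ys → Any P xs) → count P? xs ≡ count Q? ys
  count-once-cong P? Q? {xs} uxs uys onceP onceQ P⇒Q Q⇒P with any? P? xs
  ... | yes p = trans (count-once P? uxs onceP p) (sym (count-once Q? uys onceQ (P⇒Q p)))
  ... | no ¬p = trans (count-none P? ¬p) (sym (count-none Q? (¬p ∘ Q⇒P)))

open ListCounting

module Parity where
  open import Data.Nat using (_+_; _*_; _^_)

  parity : ∀ n → n % 2 ≡ 0 ⊎ n % 2 ≡ 1
  parity n with n % 2 | m%n<n n 2
  ... | 0           | _                  = inj₁ refl
  ... | 1           | _                  = inj₂ refl
  ... | suc (suc _) | s≤s (s≤s ())

  same-parity : ∀ {a b} → (2 ∣ a → 2 ∣ b) → (2 ∣ b → 2 ∣ a) → a % 2 ≡ b % 2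
  same-parity {a} {b} a⇒b b⇒a with parity a | parity b
  ... | inj₁ a%2≡0 | inj₁ b%2≡0 = trans a%2≡0 (sym b%2≡0)
  ... | inj₂ a%2≡1 | inj₂ b%2≡1 = trans a%2≡1 (sym b%2≡1)
  ... | inj₁ a%2≡0 | inj₂ b%2≡1 =
    contradiction (trans (sym b%2≡1) (n∣m⇒m%n≡0 b 2 (a⇒b (m%n≡0⇒n∣m a 2 a%2≡0)))) λ ()
  ... | inj₂ a%2≡1 | inj₁ b%2≡0 =
    contradiction (trans (sym a%2≡1) (n∣m⇒m%n≡0 a 2 (b⇒a (m%n≡0⇒n∣m b 2 b%2≡0)))) λ ()

  ^-odd : ∀ p → p % 2 ≡ 1 → ∀ k → p ^ k % 2 ≡ 1
  ^-odd p p-odd zero    = refl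
  ^-odd p p-odd (suc k) = trans (%-distribˡ-* p (p ^ k) 2)
    (cong₂ (λ x y → (x * y) % 2) p-odd (^-odd p p-odd k))

  odd⇒even-pred : ∀ n → suc n % 2 ≡ 1 → 2 ∣ n
  odd⇒even-pred n 1+n-odd with parity n
  ... | inj₁ n%2≡0 = m%n≡0⇒n∣m n 2 n%2≡0
  ... | inj₂ n%2≡1 = contradiction (trans (sym (cong (λ r → (1 + r) % 2) n%2≡1))
                                     (trans (sym (%-distribˡ-+ 1 n 2)) 1+n-odd)) λ ()

open Parity

module FieldArithmetic {q : ℕ} (F : FiniteField q) where
  open FiniteField F renaming (_+_ to infixl 6 _+_; _*_ to infixl 7 _*_; _^_ to infixr 8 _^_)

  -- F as a library commutative ring, to reuse its additive-group lemmas.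
  ring : CommutativeRing 0ℓ 0ℓ
  ring = record { isCommutativeRing = isCommutativeRing }

  open CommutativeRing ring using (+-group; *-assoc; *-identityˡ; *-identityʳ; *-comm; zeroʳ)
  open import Algebra.Properties.Group +-group using (∙-cancelˡ; ∙-cancelʳ)
  open ≡-Reasoning

  +-cancelˡ : ∀ {x y z} → x + y ≡ x + z → y ≡ z
  +-cancelˡ = ∙-cancelˡ _ _ _

  +-cancelʳ : ∀ {x y z} → y + x ≡ z + x → y ≡ z
  +-cancelʳ = ∙-cancelʳ _ _ _

  *-cancelˡ : ∀ {x y z} → x ≢ 0# → x * y ≡ x * z → y ≡ z
  *-cancelˡ {x} {y} {z} x≢0 xy≡xz with inverse x x≢0
  ... | x⁻¹ , xx⁻¹≡1 = begin
    y                ≡⟨ *-identityˡ y ⟨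
    1# * y           ≡⟨ cong (_* y) x⁻¹x≡1 ⟨
    (x⁻¹ * x) * y    ≡⟨ *-assoc x⁻¹ x y ⟩
    x⁻¹ * (x * y)    ≡⟨ cong (x⁻¹ *_) xy≡xz ⟩
    x⁻¹ * (x * z)    ≡⟨ *-assoc x⁻¹ x z ⟨
    (x⁻¹ * x) * z    ≡⟨ cong (_* z) x⁻¹x≡1 ⟩
    1# * z           ≡⟨ *-identityˡ z ⟩
    z                ∎
    where x⁻¹x≡1 = trans (*-comm x⁻¹ x) xx⁻¹≡1

  *-nonzero : ∀ {x y} → x ≢ 0# → y ≢ 0# → x * y ≢ 0#
  *-nonzero {x} x≢0 y≢0 xy≡0 = y≢0 (*-cancelˡ x≢0 (trans xy≡0 (sym (zeroʳ x))))

  ^-nonzero : ∀ {x} n → x ≢ 0# → x ^ n ≢ 0#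
  ^-nonzero zero    x≢0 = 1≢0
  ^-nonzero (suc n) x≢0 = *-nonzero x≢0 (^-nonzero n x≢0)

  ^-+ : ∀ x a b → x ^ (a ℕ.+ b) ≡ x ^ a * x ^ b
  ^-+ x zero    b = sym (*-identityˡ _)
  ^-+ x (suc a) b = trans (cong (x *_) (^-+ x a b)) (sym (*-assoc x _ _))

  ^-* : ∀ x a b → x ^ (a ℕ.* b) ≡ (x ^ b) ^ a
  ^-* x zero    b = refl
  ^-* x (suc a) b = trans (^-+ x b (a ℕ.* b)) (cong (x ^ b *_) (^-* x a b))

  1^n≡1 : ∀ n → 1# ^ n ≡ 1#
  1^n≡1 zero    = refl
  1^n≡1 (suc n) = trans (*-identityˡ _) (1^n≡1 n)

  ^-cancel : ∀ {x a b} → x ≢ 0# → a ≤ b → x ^ a ≡ x ^ b → x ^ (b ∸ a) ≡ 1#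
  ^-cancel {x} {a} {b} x≢0 a≤b xᵃ≡xᵇ = sym (*-cancelˡ (^-nonzero a x≢0) (begin
    x ^ a * 1#             ≡⟨ *-identityʳ _ ⟩
    x ^ a                  ≡⟨ xᵃ≡xᵇ ⟩
    x ^ b                  ≡⟨ cong (x ^_) (ℕ.m+[n∸m]≡n a≤b) ⟨
    x ^ (a ℕ.+ (b ∸ a))    ≡⟨ ^-+ x a (b ∸ a) ⟩
    x ^ a * x ^ (b ∸ a)    ∎))

  ^-mod : ∀ {x} d .{{_ : NonZero d}} → x ^ d ≡ 1# → ∀ k → x ^ k ≡ x ^ (k % d)
  ^-mod {x} d xᵈ≡1 k = begin
    x ^ k                                 ≡⟨ cong (x ^_) (m≡m%n+[m/n]*n k d) ⟩
    x ^ (k % d ℕ.+ (k / d) ℕ.* d)         ≡⟨ ^-+ x (k % d) _ ⟩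
    x ^ (k % d) * x ^ ((k / d) ℕ.* d)     ≡⟨ cong (x ^ (k % d) *_) (^-* x (k / d) d) ⟩
    x ^ (k % d) * (x ^ d) ^ (k / d)       ≡⟨ cong (λ y → x ^ (k % d) * y ^ (k / d)) xᵈ≡1 ⟩
    x ^ (k % d) * 1# ^ (k / d)            ≡⟨ cong (x ^ (k % d) *_) (1^n≡1 (k / d)) ⟩
    x ^ (k % d) * 1#                      ≡⟨ *-identityʳ _ ⟩
    x ^ (k % d)                           ∎

module Units {n : ℕ} (F : FiniteField (suc n)) where
  open FiniteField F
  open Inverse enumeration using (to; from; strictlyInverseˡ; strictlyInverseʳ)

  private
    to-injective : ∀ {x y} → to x ≡ to y → x ≡ y
    to-injective {x} {y} eq = trans (sym (strictlyInverseʳ x)) (trans (cong from eq) (strictlyInverseʳ y))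

    to0≢to : ∀ {x} → x ≢ 0# → to 0# ≢ to x
    to0≢to x≢0 eq = x≢0 (sym (to-injective eq))

  -- The j-th nonzero element: at least n distinct nonzero elements exist.
  unit : Fin n → Carrier
  unit j = from (punchIn (to 0#) j)

  unit-nonzero : ∀ j → unit j ≢ 0#
  unit-nonzero j eq = Fin.punchInᵢ≢i (to 0#) j (trans (sym (strictlyInverseˡ _)) (cong to eq))

  unit-injective : ∀ {i j} → unit i ≡ unit j → i ≡ j
  unit-injective {i} {j} eq = Fin.punchIn-injective (to 0#) i j
    (trans (sym (strictlyInverseˡ _)) (trans (cong to eq) (strictlyInverseˡ _)))

  -- At most n nonzero elements exist: among n+1 nonzero values two coincide.
  nonzero-collision : (f : Fin (suc n) → Carrier) → (∀ i → f i ≢ 0#) →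
                      ∃₂ λ i j → i <ᶠ j × f i ≡ f j
  nonzero-collision f f≢0 with Fin.pigeonhole (ℕ.n<1+n n) (λ i → punchOut (to0≢to (f≢0 i)))
  ... | i , j , i<j , eq = i , j , i<j , to-injective (Fin.punchOut-injective (to0≢to (f≢0 i)) (to0≢to (f≢0 j)) eq)

module Generator {n : ℕ} (F : FiniteField (suc n)) {α : FiniteField.Carrier F}
                 (gen : FiniteField.IsGenerator F α) where
  open FiniteField F renaming (_^_ to infixr 8 _^_)
  open FieldArithmetic F
  open Units F
  open ≡-Reasoning

  α≢0 : α ≢ 0#
  α≢0 = proj₁ gen

  -- Some exponent k with α^k ≡ x (not normalised), as provided by the generator.
  exponent : ∀ {x} → x ≢ 0# → ℕ
  exponent x≢0 = proj₁ (proj₂ gen _ x≢0)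

  exponent-correct : ∀ {x} (x≢0 : x ≢ 0#) → α ^ exponent x≢0 ≡ x
  exponent-correct x≢0 = proj₂ (proj₂ gen _ x≢0)

  residue : ∀ d .{{_ : NonZero d}} → Fin n → Fin d
  residue d j = fromℕ< (m%n<n (exponent (unit-nonzero j)) d)

  residue-injective : ∀ d .{{_ : NonZero d}} → α ^ d ≡ 1# → ∀ {i j} → residue d i ≡ residue d j → i ≡ j
  residue-injective d αᵈ≡1 {i} {j} same = unit-injective (begin
    unit i                ≡⟨ exponent-correct (unit-nonzero i) ⟨
    α ^ eᵢ                ≡⟨ ^-mod d αᵈ≡1 eᵢ ⟩
    α ^ (eᵢ % d)          ≡⟨ cong (α ^_) (trans (sym (Fin.toℕ-fromℕ< _)) (trans (cong toℕ same) (Fin.toℕ-fromℕ< _))) ⟩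
    α ^ (eⱼ % d)          ≡⟨ ^-mod d αᵈ≡1 eⱼ ⟨
    α ^ eⱼ                ≡⟨ exponent-correct (unit-nonzero j) ⟩
    unit j                ∎)
    where
    eᵢ = exponent (unit-nonzero i)
    eⱼ = exponent (unit-nonzero j)

  -- If α^d ≡ 1 with 0 < d < n, the n units would inject into d residues.
  order-minimal : ∀ {d} → 0 < d → d < n → α ^ d ≢ 1#
  order-minimal {suc d} _ d<n αᵈ≡1 with Fin.pigeonhole d<n (residue (suc d))
  ... | i , j , i<j , same = Fin.<-irrefl (residue-injective (suc d) αᵈ≡1 same) i<j

  ^-distinct : ∀ {a b} → a < b → b ∸ a < n → α ^ a ≢ α ^ b
  ^-distinct a<b b∸a<n αᵃ≡αᵇ =
    order-minimal (ℕ.m<n⇒0<n∸m a<b) b∸a<n (^-cancel α≢0 (ℕ.<⇒≤ a<b) αᵃ≡αᵇ)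

  -- Among α^0, …, α^n two coincide; their exponents must differ by exactly n.
  order : α ^ n ≡ 1#
  order with nonzero-collision (λ i → α ^ toℕ i) (λ i → ^-nonzero (toℕ i) α≢0)
  ... | i , j , i<j , αⁱ≡αʲ with ℕ.m≤n⇒m<n∨m≡n (ℕ.≤-trans (ℕ.m∸n≤m (toℕ j) (toℕ i)) (ℕ.≤-pred (Fin.toℕ<n j)))
  ...   | inj₁ j∸i<n = contradiction αⁱ≡αʲ (^-distinct i<j j∸i<n)
  ...   | inj₂ j∸i≡n = subst (λ d → α ^ d ≡ 1#) j∸i≡n (^-cancel α≢0 (ℕ.<⇒≤ i<j) αⁱ≡αʲ)

  ^-injective : ∀ {a b} → a < n → b < n → α ^ a ≡ α ^ b → a ≡ b
  ^-injective {a} {b} a<n b<n αᵃ≡αᵇ with ℕ.<-cmp a b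
  ... | tri< a<b _ _ = contradiction αᵃ≡αᵇ (^-distinct a<b (ℕ.≤-<-trans (ℕ.m∸n≤m b a) b<n))
  ... | tri≈ _ a≡b _ = a≡b
  ... | tri> _ _ b<a = contradiction (sym αᵃ≡αᵇ) (^-distinct b<a (ℕ.≤-<-trans (ℕ.m∸n≤m a b) a<n))

  log : .{{_ : NonZero n}} → ∀ {x} → x ≢ 0# → ∃ λ i → i < n × α ^ i ≡ x
  log x≢0 = exponent x≢0 % n , m%n<n (exponent x≢0) n ,
    trans (sym (^-mod n order (exponent x≢0))) (exponent-correct x≢0)

field-size : ∀ {q} → FiniteField q → ∃ λ m → q ≡ suc (suc m)
field-size {zero} F = contradiction (Inverse.to (FiniteField.enumeration F) (FiniteField.0# F)) Fin.¬Fin0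
field-size {suc zero} F with Units.nonzero-collision F (λ _ → FiniteField.1# F) (λ _ → FiniteField.1≢0 F)
... | Fin.zero , Fin.zero , () , _
field-size {suc (suc m)} F = m , refl

module LogParity {n : ℕ} .{{_ : NonZero n}} (F : FiniteField (suc n)) (2∣n : 2 ∣ n) where
  open FiniteField F renaming (_^_ to infixr 8 _^_)
  open FieldArithmetic F using (^-*; ^-mod)
  open ≡-Reasoning

  -- Write α = γ^c; then b ≡ a·c (mod n), which is even when a is.
  log-even : ∀ {α γ a b} → IsGenerator α → IsGenerator γ → a < n → b < n →
             α ^ a ≡ γ ^ b → 2 ∣ a → 2 ∣ b
  log-even {α} {γ} {a} {b} gα gγ a<n b<n αᵃ≡γᵇ 2∣a =
    subst (2 ∣_) (sym b≡ac%n) (%-presˡ-∣ (∣m⇒∣m*n c 2∣a) 2∣n)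
    where
    open Generator F gγ using (exponent; exponent-correct; order; ^-injective)
    c : ℕ
    c = exponent (proj₁ gα)
    b≡ac%n : b ≡ (a ℕ.* c) % n
    b≡ac%n = ^-injective b<n (m%n<n (a ℕ.* c) n) (begin
      γ ^ b                ≡⟨ αᵃ≡γᵇ ⟨
      α ^ a                ≡⟨ cong (_^ a) (exponent-correct (proj₁ gα)) ⟨
      (γ ^ c) ^ a          ≡⟨ ^-* γ a c ⟨
      γ ^ (a ℕ.* c)        ≡⟨ ^-mod n order (a ℕ.* c) ⟩
      γ ^ ((a ℕ.* c) % n)  ∎)

  log-parity : ∀ {α γ a b} → IsGenerator α → IsGenerator γ → a < n → b < n →
               α ^ a ≡ γ ^ b → a % 2 ≡ b % 2
  log-parity gα gγ a<n b<n αᵃ≡γᵇ =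
    same-parity (log-even gα gγ a<n b<n αᵃ≡γᵇ) (log-even gγ gα b<n a<n (sym αᵃ≡γᵇ))

module GolombCostas (m : ℕ) (F : FiniteField (suc (suc m))) (2∣q-1 : 2 ∣ suc m) where
  open FiniteField F renaming (_+_ to infixl 6 _+_; _^_ to infixr 8 _^_; _≟_ to infix 4 _≟_)
  open FieldArithmetic F using (+-cancelˡ; +-cancelʳ; ^-nonzero)
  open LogParity F 2∣q-1 using (log-parity)
  open ≡-Reasoning

  I : List ℕ
  I = indices (suc (suc m))

  I-unique : Unique I
  I-unique = Unique.map⁺ ℕ.suc-injective (Unique.upTo⁺ m)

  ∈I⁻ : ∀ {i} → i ∈ I → 0 < i × i < suc m
  ∈I⁻ i∈I with ∈-map⁻ suc i∈I
  ... | j , j∈upTo , refl = s≤s z≤n , s≤s (∈-upTo⁻ j∈upTo)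

  ∈I⁺ : ∀ {i} → 0 < i → i < suc m → i ∈ I
  ∈I⁺ {suc j} _ (s≤s j<m) = ∈-map⁺ suc (∈-upTo⁺ j<m)

  reindex : ∀ {α α′} → IsGenerator α → IsGenerator α′ → ∀ {i} → i ∈ I →
            ∃ λ i′ → i′ ∈ I × i′ % 2 ≡ i % 2 × α′ ^ i′ ≡ α ^ i
  reindex {α} {α′} gα gα′ {i} i∈I with Generator.log F gα′ (^-nonzero i (proj₁ gα))
  ... | i′ , i′<q-1 , α′ⁱ′≡αⁱ =
    i′ , ∈I⁺ (ℕ.n≢0⇒n>0 i′≢0) i′<q-1 , log-parity gα′ gα i′<q-1 i<q-1 α′ⁱ′≡αⁱ , α′ⁱ′≡αⁱ
    where
    i<q-1 : i < suc m
    i<q-1 = proj₂ (∈I⁻ i∈I)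
    -- α^i ≡ 1 = α^0 would force i ≡ 0
    i′≢0 : i′ ≢ 0
    i′≢0 refl = ℕ.<⇒≢ (proj₁ (∈I⁻ i∈I))
                  (sym (Generator.^-injective F gα i<q-1 (s≤s z≤n) (sym α′ⁱ′≡αⁱ)))

  exponent-count-invariant : ∀ {ℓ} {P : ℕ → Carrier → Set ℓ} (P? : ∀ p x → Dec (P p x)) →
    (∀ {p p′ x x′} → P p x → P p′ x′ → x ≡ x′) →
    ∀ {α α′} → IsGenerator α → IsGenerator α′ →
    count (λ i → P? (i % 2) (α ^ i)) I ≡ count (λ i → P? (i % 2) (α′ ^ i)) I
  exponent-count-invariant {P = P} P? determines gα gα′ =
    count-once-cong _ _ I-unique I-unique (once gα) (once gα′) (transfer gα gα′) (transfer gα′ gα)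
    where
    once : ∀ {α} → IsGenerator α → AtMostOnce (λ i → P (i % 2) (α ^ i)) I
    once gα i∈I j∈I Pᵢ Pⱼ =
      Generator.^-injective F gα (proj₂ (∈I⁻ i∈I)) (proj₂ (∈I⁻ j∈I)) (determines Pᵢ Pⱼ)
    transfer : ∀ {α α′} → IsGenerator α → IsGenerator α′ →
               Any (λ i → P (i % 2) (α ^ i)) I → Any (λ i → P (i % 2) (α′ ^ i)) I
    transfer gα gα′ any =
      let i , i∈I , Pᵢ = find any
          i′ , i′∈I , i′≡i[2] , α′ⁱ′≡αⁱ = reindex gα gα′ i∈I
      in lose i′∈I (subst₂ P (sym i′≡i[2]) (sym α′ⁱ′≡αⁱ) Pᵢ)

  IsDot : Carrier → Carrier → ℕ → ℕ → Pred (ℕ × ℕ) 0ℓ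
  IsDot α β a b ij = (proj₁ ij % 2 ≡ a × proj₂ ij % 2 ≡ b) × α ^ proj₁ ij + β ^ proj₂ ij ≡ 1#

  isDot? : ∀ α β a b → Decidable (IsDot α β a b)
  isDot? α β a b ij = ((proj₁ ij % 2) ≟ℕ a ×-dec (proj₂ ij % 2) ≟ℕ b) ×-dec (α ^ proj₁ ij + β ^ proj₂ ij ≟ 1#)

  -- Counting row by row: in row i a dot is determined by the value β^j, so each
  -- row count is invariant under changing the column generator β.
  column-generator-invariant : ∀ α {β β′} a b → IsGenerator β → IsGenerator β′ →
                               dotCount F α β a b ≡ dotCount F α β′ a b
  column-generator-invariant α {β} {β′} a b gβ gβ′ = begin
    dotCount F α β a b
      ≡⟨ count-cartesianProduct (isDot? α β a b) I I ⟩
    ∑ I (λ i → count (λ j → isDot? α β a b (i , j)) I)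
      ≡⟨ ∑-cong I (λ i → exponent-count-invariant (inRow i) (determines i) gβ gβ′) ⟩
    ∑ I (λ i → count (λ j → isDot? α β′ a b (i , j)) I)
      ≡⟨ count-cartesianProduct (isDot? α β′ a b) I I ⟨
    dotCount F α β′ a b ∎
    where
    -- in row i, column parity p and value y = β^j
    inRow : ∀ i p y → Dec ((i % 2 ≡ a × p ≡ b) × α ^ i + y ≡ 1#)
    inRow i p y = ((i % 2) ≟ℕ a ×-dec p ≟ℕ b) ×-dec (α ^ i + y ≟ 1#)
    determines : ∀ i {p p′ y y′} → (i % 2 ≡ a × p ≡ b) × α ^ i + y ≡ 1# →
                 (i % 2 ≡ a × p′ ≡ b) × α ^ i + y′ ≡ 1# → y ≡ y′
    determines i (_ , e) (_ , e′) = +-cancelˡ (trans e (sym e′))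

  -- Counting column by column: symmetrically, each column count is invariant
  -- under changing the row generator α.
  row-generator-invariant : ∀ {α α′} β a b → IsGenerator α → IsGenerator α′ →
                            dotCount F α β a b ≡ dotCount F α′ β a b
  row-generator-invariant {α} {α′} β a b gα gα′ = begin
    dotCount F α β a b
      ≡⟨ count-cartesianProduct-columns (isDot? α β a b) I I ⟩
    ∑ I (λ j → count (λ i → isDot? α β a b (i , j)) I)
      ≡⟨ ∑-cong I (λ j → exponent-count-invariant (inColumn j) (determines j) gα gα′) ⟩
    ∑ I (λ j → count (λ i → isDot? α′ β a b (i , j)) I)
      ≡⟨ count-cartesianProduct-columns (isDot? α′ β a b) I I ⟨
    dotCount F α′ β a b ∎
    where
    -- in column j, row parity p and value x = α^i
    inColumn : ∀ j p x → Dec ((p ≡ a × j % 2 ≡ b) × x + β ^ j ≡ 1#)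
    inColumn j p x = (p ≟ℕ a ×-dec (j % 2) ≟ℕ b) ×-dec (x + β ^ j ≟ 1#)
    determines : ∀ j {p p′ x x′} → (p ≡ a × j % 2 ≡ b) × x + β ^ j ≡ 1# →
                 (p′ ≡ a × j % 2 ≡ b) × x′ + β ^ j ≡ 1# → x ≡ x′
    determines j (_ , e) (_ , e′) = +-cancelʳ (trans e (sym e′))

  dotCount-invariant : ∀ {α β α′ β′} a b → IsGenerator α → IsGenerator β →
                       IsGenerator α′ → IsGenerator β′ → dotCount F α β a b ≡ dotCount F α′ β′ a b
  dotCount-invariant {β = β} {α′} a b gα gβ gα′ gβ′ =
    trans (row-generator-invariant β a b gα gα′) (column-generator-invariant α′ a b gβ gβ′)

open import Data.Nat using (_^_)

corollary7 : (p k q : ℕ) → Prime p → p % 2 ≡ 1 → q ≡ p ^ suc k →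
    (F : FiniteField q) →
    (α β α′ β′ : FiniteField.Carrier F) →
    FiniteField.IsGenerator F α → FiniteField.IsGenerator F β →
    FiniteField.IsGenerator F α′ → FiniteField.IsGenerator F β′ →
    (evenEven F α β ≡ evenEven F α′ β′) × (oddOdd F α β ≡ oddOdd F α′ β′) ×
    (evenOdd F α β ≡ evenOdd F α′ β′) × (oddEven F α β ≡ oddEven F α′ β′)
corollary7 p k q _ p-odd q≡pᵏ⁺¹ F α β α′ β′ gα gβ gα′ gβ′ with field-size F
... | m , refl = invariant 0 0 , invariant 1 1 , invariant 0 1 , invariant 1 0
  where
  -- q = p^(k+1) is odd, so |F^*| = q - 1 is even
  2∣q-1 : 2 ∣ suc m
  2∣q-1 = odd⇒even-pred (suc m) (trans (cong (_% 2) q≡pᵏ⁺¹) (^-odd p p-odd (suc k)))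
  invariant : ∀ a b → dotCount F α β a b ≡ dotCount F α′ β′ a b
  invariant a b = GolombCostas.dotCount-invariant m F 2∣q-1 a b gα gβ gα′ gβ′
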